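{- Let $T$ be a tree. For $j\ge1$ let $L_j$ be the set of vertices of $T$ whose distance to the nearest leaf is $j-1$ (so $L_1$ is the set of leaves), and let $\ell_j=|L_j|$. Then for every positive integer $k$ such that $L_k$ is nonempty, \[Z^{(k)}(T)\leq \sum_{i=1}^k \ell_i - 1.\]
   Context: Zero forcing on a simple graph $H$: an initial set is blue; repeatedly, a blue vertex with exactly one white neighbor forces that neighbor blue; $Z(H)$ is the minimum size of an initial set making all vertices blue. A lazy walk of length $r$ in $T$ is a sequence $u_0,\ldots,u_r$ with $u_{t+1}=u_t$ or $u_tu_{t+1}\in E(T)$. $\Gamma(T,r)$ is the multigraph on $V(T)$ with the number of edges between distinct $i,j$ equal to the number of lazy walks from $i$ to $j$ of length at most $r$. An edge configuration of a multigraph $\Gamma$ is a simple graph $H$ on its vertex set such that a pair joined by exactly one edge in $\Gamma$ is an edge of $H$, a pair joined by no edge is not, and a pair joined by two or more edges may or may not be. $Z^{(r)}(T)=\max Z(H)$ over all edge configurations $H$ of $\Gamma(T,r)$. -}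

module Defs where

open import Data.Nat using (ℕ; zero; suc; _+_; _*_; _∸_; _≤_; _<_)
open import Data.Bool using (Bool; true; false; _∧_; _∨_; not; if_then_else_)
open import Data.Fin using (Fin; toℕ; _≟_)
open import Data.List using (List; []; _∷_; map; sum)
open import Data.List using (upTo)
open import Data.Fin using () renaming (_≟_ to _≟F_)
open import Data.List using () renaming (map to lmap)
open import Data.Vec.Functional using () renaming (foldr to vfoldr)
open import Data.Product using (Σ; ∃; _×_; _,_)
open import Relation.Nullary using (¬_; does)
open import Relation.Binary.PropositionalEquality using (_≡_; _≢_)
open import Relation.Binary.Construct.Closure.ReflexiveTransitive using (Star)

ΣFin : ∀ {n} → (Fin n → ℕ) → ℕ
ΣFin {n} f = vfoldr (λ a b → a + b) 0 f

Σupto : ℕ → (ℕ → ℕ) → ℕ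
Σupto zero    f = f 0
Σupto (suc r) f = Σupto r f + f (suc r)

Σ1to : ℕ → (ℕ → ℕ) → ℕ
Σ1to zero    f = 0
Σ1to (suc k) f = Σ1to k f + f (suc k)

b2n : Bool → ℕ
b2n true  = 1
b2n false = 0

card : ∀ {n} → (Fin n → Bool) → ℕ
card S = ΣFin (λ i → b2n (S i))

_==_ : ∀ {n} → Fin n → Fin n → Bool
i == j = does (i ≟F j)

Adj : ℕ → Set
Adj n = Fin n → Fin n → Bool

record SimpleGraph (n : ℕ) : Set where
  field
    adj   : Adj n
    sym   : ∀ i j → adj i j ≡ adj j i
    irrefl : ∀ i → adj i i ≡ false
open SimpleGraph public

walks : ∀ {n} → Adj n → ℕ → Fin n → Fin n → ℕ
walks A zero    i j = b2n (i == j)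
walks A (suc r) i j = ΣFin (λ k → b2n (A i k) * walks A r k j)

lazyWalks : ∀ {n} → Adj n → ℕ → Fin n → Fin n → ℕ
lazyWalks A zero    i j = b2n (i == j)
lazyWalks A (suc r) i j = ΣFin (λ k → b2n ((i == k) ∨ A i k) * lazyWalks A r k j)

degree : ∀ {n} → SimpleGraph n → Fin n → ℕ
degree G v = card (adj G v)

edgeCount : ∀ {n} → SimpleGraph n → ℕ
edgeCount G = ΣFin (λ i → ΣFin (λ j → b2n (does (Data.Nat._<?_ (toℕ i) (toℕ j)) ∧ adj G i j)))
  where import Data.Nat

record IsTree {n : ℕ} (T : SimpleGraph n) : Set where
  field
    nonempty  : 1 ≤ n
    connected : ∀ u v → ∃ λ d → 0 < walks (adj T) d u v
    edges     : edgeCount T ≡ n ∸ 1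

isLeaf : ∀ {n} → SimpleGraph n → Fin n → Bool
isLeaf G v = does (degree G v Data.Nat.≟ 1)
  where import Data.Nat

within : ∀ {n} → SimpleGraph n → ℕ → Fin n → Fin n → Bool
within G d u v = does (1 Data.Nat.≤? Σupto d (λ s → walks (adj G) s u v))
  where import Data.Nat

leafWithin : ∀ {n} → SimpleGraph n → ℕ → Fin n → Bool
leafWithin G d v = does (1 Data.Nat.≤? ΣFin (λ w → b2n (isLeaf G w ∧ within G d v w)))
  where import Data.Nat

-- inLayer G j v : v ∈ L_j, i.e. the distance from v to the nearest leaf is j - 1
-- (L_0 is empty; only j ≥ 1 is meaningful)
inLayer : ∀ {n} → SimpleGraph n → ℕ → Fin n → Bool
inLayer G zero          v = false
inLayer G (suc zero)    v = leafWithin G 0 v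
inLayer G (suc (suc m)) v = leafWithin G (suc m) v ∧ not (leafWithin G m v)

layerSize : ∀ {n} → SimpleGraph n → ℕ → ℕ
layerSize G j = card (inLayer G j)

-- number of edges of Γ(T,r) between i and j (for i ≠ j):
-- number of lazy walks from i to j of length at most r
Γmult : ∀ {n} → SimpleGraph n → ℕ → Fin n → Fin n → ℕ
Γmult T r i j = Σupto r (λ s → lazyWalks (adj T) s i j)

record IsEdgeConfiguration {n : ℕ} (T : SimpleGraph n) (r : ℕ) (H : SimpleGraph n) : Set where
  field
    single : ∀ i j → i ≢ j → Γmult T r i j ≡ 1 → adj H i j ≡ true
    none   : ∀ i j → i ≢ j → Γmult T r i j ≡ 0 → adj H i j ≡ false

Colouring : ℕ → Set
Colouring n = Fin n → Bool   -- true = blue, false = white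

record Force {n : ℕ} (H : SimpleGraph n) (B B′ : Colouring n) : Set where
  field
    u v      : Fin n
    uBlue    : B u ≡ true
    vWhite   : B v ≡ false
    uv       : adj H u v ≡ true
    othersBlue : ∀ w → adj H u w ≡ true → w ≢ v → B w ≡ true
    vNowBlue : B′ v ≡ true
    unchanged : ∀ x → x ≢ v → B′ x ≡ B x

IsZeroForcingSet : ∀ {n} → SimpleGraph n → Colouring n → Set
IsZeroForcingSet H S = ∃ λ B → Star (Force H) S B × (∀ x → B x ≡ true)

IsZ : ∀ {n} → SimpleGraph n → ℕ → Set
IsZ H z = (∃ λ S → IsZeroForcingSet H S × card S ≡ z)
        × (∀ S → IsZeroForcingSet H S → z ≤ card S)

IsZr : ∀ {n} → SimpleGraph n → ℕ → ℕ → Set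
IsZr T r z = (∃ λ H → IsEdgeConfiguration T r H × IsZ H z)
           × (∀ H z′ → IsEdgeConfiguration T r H → IsZ H z′ → z′ ≤ z)

-- Root T at a leaf ρ from which some vertex lies at distance k (there is one because L_k is
-- nonempty), and let S consist of the vertices within distance k - 1 of a leaf, except ρ, so that
-- |S| = ℓ_1 + ⋯ + ℓ_k - 1.  In any edge configuration H of Γ(T, k), S is a zero forcing set.
-- Let w be a deepest white vertex.  Either w = ρ or w is farther than k - 1 from every leaf; in
-- both cases some u lies exactly k levels below w.  The path from u up to w is the only lazy walk
-- of length at most k between them, so uw is an edge of H.  Every other H-neighbour x of u is
-- within distance k of u; were x white, it would be no deeper than w, so the walk from x to u
-- would climb k levels in k steps, i.e. x is the k-th ancestor of u, which is w.  So u forces w.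
-- The tree structure enters only through the parent map: the n - 1 parent edges are edges of T,
-- and T has only n - 1 edges.

module Submission where

open import Algebra.Properties.Semiring.Sum as Sum using ()
open import Data.Bool using (Bool; true; false; _∧_; _∨_; not)
import Data.Bool.Properties as Boolₚ
open import Data.Empty using (⊥-elim)
open import Data.Fin using (Fin; toℕ) renaming (zero to fzero; suc to fsuc)
import Data.Fin.Properties as Finₚ
open import Data.List using (filter; allFin)
open import Data.List.Membership.Propositional.Properties using (∈-filter⁺; ∈-allFin)
open import Data.List.Relation.Unary.All using (lookup)
open import Data.List.Relation.Unary.All.Properties using (all-filter)
open import Data.Nat using (ℕ; zero; suc; _+_; _*_; _∸_; _≤_; _<_; z≤n; s≤s; _≤?_; _<?_; _≟_)
open import Data.Nat.Induction using (<-rec)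
open import Data.Nat.Properties
open import Data.List.Extrema ≤-totalOrder using (argmax; argmax-all; f[xs]≤f[argmax])
open import Data.Product using (∃; _×_; _,_; proj₁; proj₂)
open import Data.Sum using (_⊎_; inj₁; inj₂)
open import Function using (_∘_)
open import Relation.Binary.Construct.Closure.ReflexiveTransitive using (Star; ε; _◅_)
open import Relation.Binary.Definitions using (tri<; tri≈; tri>)
open import Relation.Binary.PropositionalEquality
open import Relation.Nullary using (¬_; Dec; yes; no; does; ¬?)
open import Relation.Nullary.Decidable using (dec-true; dec-false; map′; _×-dec_)
import Relation.Unary as U

open import Defs hiding (sym)

-- Natural numbers and finite sums

-- ΣFin is definitionally the library's sum over a vector of naturals.
open Sum +-*-semiring using (sum-cong-≗; sum-replicate-zero; ∑-distrib-+; ∑-comm)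

ΣFin-mono-≤ : ∀ {n} {f g : Fin n → ℕ} → (∀ i → f i ≤ g i) → ΣFin f ≤ ΣFin g
ΣFin-mono-≤ {zero}  f≤g = z≤n
ΣFin-mono-≤ {suc n} f≤g = +-mono-≤ (f≤g fzero) (ΣFin-mono-≤ (f≤g ∘ fsuc))

ΣFin-mono-≤-tight : ∀ {n} {f g : Fin n → ℕ} → (∀ i → f i ≤ g i) → ΣFin g ≤ ΣFin f →
                    ∀ i → f i ≡ g i
ΣFin-mono-≤-tight {suc n} f≤g Σg≤Σf fzero =
  ≤-antisym (f≤g fzero)
    (+-cancelʳ-≤ _ _ _ (≤-trans (+-monoʳ-≤ _ (ΣFin-mono-≤ (f≤g ∘ fsuc))) Σg≤Σf))
ΣFin-mono-≤-tight {suc n} f≤g Σg≤Σf (fsuc i) =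
  ΣFin-mono-≤-tight (f≤g ∘ fsuc)
    (+-cancelˡ-≤ _ _ _ (≤-trans Σg≤Σf (+-monoˡ-≤ _ (f≤g fzero)))) i

≤-ΣFin : ∀ {n} (f : Fin n → ℕ) i → f i ≤ ΣFin f
≤-ΣFin f fzero    = m≤m+n _ _
≤-ΣFin f (fsuc i) = ≤-trans (≤-ΣFin (f ∘ fsuc) i) (m≤n+m _ _)

ΣFin-positive : ∀ {n} (f : Fin n → ℕ) → 0 < ΣFin f → ∃ λ i → 0 < f i
ΣFin-positive {suc n} f Σf>0 with f fzero in eq
... | suc _ = fzero , subst (0 <_) (sym eq) (s≤s z≤n)
... | zero  = let i , fi>0 = ΣFin-positive (f ∘ fsuc) Σf>0 in fsuc i , fi>0

ΣFin-at : ∀ {n} (f : Fin n → ℕ) i → (∀ j → j ≢ i → f j ≡ 0) → ΣFin f ≡ f i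
ΣFin-at {suc n} f fzero    off = begin
  f fzero + ΣFin (f ∘ fsuc)  ≡⟨ cong (f fzero +_) (sum-cong-≗ {n} λ j → off (fsuc j) λ ()) ⟩
  f fzero + ΣFin {n} (λ _ → 0) ≡⟨ cong (f fzero +_) (sum-replicate-zero n) ⟩
  f fzero + 0                ≡⟨ +-identityʳ (f fzero) ⟩
  f fzero                    ∎
  where open ≡-Reasoning
ΣFin-at {suc n} f (fsuc i) off =
  trans (cong (_+ ΣFin (f ∘ fsuc)) (off fzero λ ()))
        (ΣFin-at (f ∘ fsuc) i λ j j≢i → off (fsuc j) (j≢i ∘ Finₚ.suc-injective))

ΣΣ : ∀ {n} → (Fin n → Fin n → ℕ) → ℕ
ΣΣ f = ΣFin λ i → ΣFin λ j → f i j

ΣΣ-cong : ∀ {n} {f g : Fin n → Fin n → ℕ} → (∀ i j → f i j ≡ g i j) → ΣΣ f ≡ ΣΣ g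
ΣΣ-cong {n} f≡g = sum-cong-≗ {n} λ i → sum-cong-≗ {n} (f≡g i)

ΣΣ-distrib-+ : ∀ {n} (f g : Fin n → Fin n → ℕ) → ΣΣ (λ i j → f i j + g i j) ≡ ΣΣ f + ΣΣ g
ΣΣ-distrib-+ {n} f g =
  trans (sum-cong-≗ {n} λ i → ∑-distrib-+ (f i) (g i))
        (∑-distrib-+ (λ i → ΣFin (f i)) (λ i → ΣFin (g i)))

ΣΣ-transpose : ∀ {n} (f : Fin n → Fin n → ℕ) → ΣΣ f ≡ ΣΣ (λ i j → f j i)
ΣΣ-transpose = ∑-comm

ΣΣ-mono-≤-tight : ∀ {n} {f g : Fin n → Fin n → ℕ} → (∀ i j → f i j ≤ g i j) → ΣΣ g ≤ ΣΣ f →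
                  ∀ i j → f i j ≡ g i j
ΣΣ-mono-≤-tight f≤g ΣΣg≤ΣΣf i =
  ΣFin-mono-≤-tight (f≤g i)
    (≤-reflexive (sym (ΣFin-mono-≤-tight (λ i → ΣFin-mono-≤ (f≤g i)) ΣΣg≤ΣΣf i)))

Σupto-positive : ∀ d f → 0 < Σupto d f → ∃ λ s → s ≤ d × 0 < f s
Σupto-positive zero    f 0<f0 = 0 , z≤n , 0<f0
Σupto-positive (suc d) f 0<Σ with 1 ≤? f (suc d)
... | yes 0<fd = suc d , ≤-refl , 0<fd
... | no  fd≯0 =
  let s , s≤d , 0<fs = Σupto-positive d f (subst (0 <_) Σ≡ 0<Σ) in s , m≤n⇒m≤1+n s≤d , 0<fs
  where
  Σ≡ : Σupto d f + f (suc d) ≡ Σupto d f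
  Σ≡ = trans (cong (Σupto d f +_) (n<1⇒n≡0 (≰⇒> fd≯0))) (+-identityʳ _)

≤-Σupto : ∀ d f {s} → s ≤ d → f s ≤ Σupto d f
≤-Σupto zero    f z≤n = ≤-refl
≤-Σupto (suc d) f s≤1+d with m≤n⇒m<n∨m≡n s≤1+d
... | inj₁ s<1+d = ≤-trans (≤-Σupto d f (m<1+n⇒m≤n s<1+d)) (m≤m+n _ _)
... | inj₂ refl  = m≤n+m _ _

Σupto-last : ∀ d f → (∀ {s} → s < d → f s ≡ 0) → Σupto d f ≡ f d
Σupto-last zero    f _        = refl
Σupto-last (suc d) f vanishes =
  cong (_+ f (suc d)) (Σupto-vanishing d λ s≤d → vanishes (s≤s s≤d))
  where
  Σupto-vanishing : ∀ d → (∀ {s} → s ≤ d → f s ≡ 0) → Σupto d f ≡ 0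
  Σupto-vanishing zero    vanishes = vanishes z≤n
  Σupto-vanishing (suc d) vanishes =
    cong₂ _+_ (Σupto-vanishing d (vanishes ∘ m≤n⇒m≤1+n)) (vanishes ≤-refl)

+-mono-≤-tight : ∀ {a b c d} → c ≤ a → d ≤ b → a + b ≤ c + d → c ≡ a × d ≡ b
+-mono-≤-tight {a} {b} {c} {d} c≤a d≤b a+b≤c+d =
  ≤-antisym c≤a (+-cancelʳ-≤ b a c (≤-trans a+b≤c+d (+-monoʳ-≤ c d≤b))) ,
  ≤-antisym d≤b (+-cancelˡ-≤ a b d (≤-trans a+b≤c+d (+-monoˡ-≤ d c≤a)))

Least : ∀ {p} → (ℕ → Set p) → ℕ → Set p
Least P μ = P μ × (∀ {s} → s < μ → ¬ P s)

least : ∀ {p} {P : ℕ → Set p} → U.Decidable P → ∀ {m} → P m → ∃ (Least P)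
least {P = P} P? {m} = <-rec (λ m → P m → ∃ (Least P)) step m
  where
  step : ∀ m → (∀ {s} → s < m → P s → ∃ (Least P)) → P m → ∃ (Least P)
  step m smaller Pm with anyUpTo? P? m
  ... | yes (s , s<m , Ps) = smaller s<m Ps
  ... | no none            = m , Pm , λ s<m Ps → none (_ , s<m , Ps)

-- Booleans and cardinalities

does-true⇒ : ∀ {a} {A : Set a} (a? : Dec A) → does a? ≡ true → A
does-true⇒ (yes a) _ = a

does-false⇒ : ∀ {a} {A : Set a} (a? : Dec A) → does a? ≡ false → ¬ A
does-false⇒ (no ¬a) _ = ¬a

==-refl : ∀ {n} (i : Fin n) → (i == i) ≡ true
==-refl i = dec-true (i Finₚ.≟ i) refl

==-sound : ∀ {n} {i j : Fin n} → (i == j) ≡ true → i ≡ j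
==-sound {i = i} {j} = does-true⇒ (i Finₚ.≟ j)

≢⇒==-false : ∀ {n} {i j : Fin n} → i ≢ j → (i == j) ≡ false
≢⇒==-false {i = i} {j} = dec-false (i Finₚ.≟ j)

not-∨ : ∀ x y → not (x ∨ y) ≡ not x ∧ not y
not-∨ true  y = refl
not-∨ false y = refl

∨-true⇒ : ∀ {x y} → x ∨ y ≡ true → x ≡ true ⊎ y ≡ true
∨-true⇒ {true}  _  = inj₁ refl
∨-true⇒ {false} xy = inj₂ xy

b2n-positive : ∀ {b} → 0 < b2n b → b ≡ true
b2n-positive {true} _ = refl

b2n-*-positive : ∀ b x → 0 < b2n b * x → b ≡ true × 0 < x
b2n-*-positive true x 0<x+0 = refl , subst (0 <_) (+-identityʳ x) 0<x+0

b2n-split : ∀ x y → (y ≡ true → x ≡ true) → b2n x ≡ b2n y + b2n (x ∧ not y)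
b2n-split x     true  y⇒x rewrite y⇒x refl = refl
b2n-split true  false _   = refl
b2n-split false false _   = refl

b2n-∧-mono : ∀ x {y z} → (y ≡ true → z ≡ true) → b2n (x ∧ y) ≤ b2n (x ∧ z)
b2n-∧-mono false         _   = z≤n
b2n-∧-mono true  {false} _   = z≤n
b2n-∧-mono true  {true}  y⇒z rewrite y⇒z refl = ≤-refl

b2n-∧-∨ : ∀ x y z → (y ≡ true → z ≡ false) → b2n (x ∧ (y ∨ z)) ≡ b2n (x ∧ y) + b2n (x ∧ z)
b2n-∧-∨ false y     z _    = refl
b2n-∧-∨ true  true  z y⇒¬z rewrite y⇒¬z refl = refl
b2n-∧-∨ true  false z _    = refl

card-full : ∀ n → card {n} (λ _ → true) ≡ n
card-full zero    = refl
card-full (suc n) = cong suc (card-full n)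

card-positive : ∀ {n} (S : Fin n → Bool) {x} → S x ≡ true → 0 < card S
card-positive S {x} Sx = ≤-trans (≤-reflexive (cong b2n (sym Sx))) (≤-ΣFin (λ v → b2n (S v)) x)

card-singleton : ∀ {n} (a : Fin n) → card (_== a) ≡ 1
card-singleton a =
  trans (ΣFin-at _ a λ j j≢a → cong b2n (≢⇒==-false j≢a)) (cong b2n (==-refl a))

card-split : ∀ {n} (S R : Fin n → Bool) → (∀ v → R v ≡ true → S v ≡ true) →
             card S ≡ card R + card (λ v → S v ∧ not (R v))
card-split {n} S R R⊆S =
  trans (sum-cong-≗ {n} λ v → b2n-split (S v) (R v) (R⊆S v))
        (∑-distrib-+ (λ v → b2n (R v)) (λ v → b2n (S v ∧ not (R v))))

card-remove : ∀ {n} (S : Fin n → Bool) {a} → S a ≡ true →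
              card (λ v → S v ∧ not (v == a)) ≡ card S ∸ 1
card-remove S {a} Sa = begin
  card S∖a                     ≡⟨ cong (λ m → m + card S∖a ∸ 1) (card-singleton a) ⟨
  card (_== a) + card S∖a ∸ 1  ≡⟨ cong (_∸ 1) (card-split S (_== a) a⇒S) ⟨
  card S ∸ 1                   ∎
  where
  open ≡-Reasoning
  S∖a = λ v → S v ∧ not (v == a)
  a⇒S : ∀ v → (v == a) ≡ true → S v ≡ true
  a⇒S v v=a = subst (λ v → S v ≡ true) (sym (==-sound v=a)) Sa

card≥2⇒∃≢ : ∀ {n} (S : Fin n → Bool) a → 2 ≤ card S → ∃ λ b → b ≢ a × S b ≡ true
card≥2⇒∃≢ S a 2≤|S| with Finₚ.any? (λ b → ¬? (b Finₚ.≟ a) ×-dec (S b Boolₚ.≟ true))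
... | yes other = other
... | no none   = ⊥-elim (<⇒≱ 2≤|S| (begin
  card S     ≡⟨ ΣFin-at _ a (λ b b≢a → cong b2n (Boolₚ.¬-not λ Sb → none (b , b≢a , Sb))) ⟩
  b2n (S a)  ≤⟨ b2n≤1 (S a) ⟩
  1          ∎))
  where
  open ≤-Reasoning
  b2n≤1 : ∀ x → b2n x ≤ 1
  b2n≤1 true  = ≤-refl
  b2n≤1 false = z≤n

argmax-Fin : ∀ {n} (P : Fin n → Bool) (f : Fin n → ℕ) {a} → P a ≡ true →
             ∃ λ w → P w ≡ true × (∀ v → P v ≡ true → f v ≤ f w)
argmax-Fin {n} P f {a} Pa =
  w , argmax-all f Pa (all-filter P? (allFin n)) ,
  λ v Pv → lookup (f[xs]≤f[argmax] a candidates) (∈-filter⁺ P? (∈-allFin v) Pv)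
  where
  P? = λ v → P v Boolₚ.≟ true
  candidates = filter P? (allFin n)
  w = argmax f a candidates

-- Counting unordered pairs

lt : ∀ {n} → Fin n → Fin n → Bool
lt i j = does (toℕ i <? toℕ j)

-- edgeCount G is definitionally pairCount (adj G).
pairCount : ∀ {n} → (Fin n → Fin n → Bool) → ℕ
pairCount A = ΣΣ λ i j → b2n (lt i j ∧ A i j)

lt-total : ∀ {n} {i j : Fin n} → i ≢ j → b2n (lt i j) + b2n (lt j i) ≡ 1
lt-total {i = i} {j} i≢j with <-cmp (toℕ i) (toℕ j)
... | tri< i<j _ j≮i rewrite dec-true (toℕ i <? toℕ j) i<j | dec-false (toℕ j <? toℕ i) j≮i = refl
... | tri≈ _ i=j _   = ⊥-elim (i≢j (Finₚ.toℕ-injective i=j))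
... | tri> i≮j _ j<i rewrite dec-false (toℕ i <? toℕ j) i≮j | dec-true (toℕ j <? toℕ i) j<i = refl

pairCount-symmetrise : ∀ {n} (K : Fin n → Fin n → Bool) → (∀ i j → K i j ≡ true → K j i ≡ false) →
                       pairCount (λ i j → K i j ∨ K j i) ≡ ΣΣ (λ i j → b2n (K i j))
pairCount-symmetrise K asym = begin
  pairCount (λ i j → K i j ∨ K j i)
    ≡⟨ ΣΣ-cong (λ i j → b2n-∧-∨ (lt i j) (K i j) (K j i) (asym i j)) ⟩
  ΣΣ (λ i j → b2n (lt i j ∧ K i j) + b2n (lt i j ∧ K j i))
    ≡⟨ ΣΣ-distrib-+ (λ i j → b2n (lt i j ∧ K i j)) (λ i j → b2n (lt i j ∧ K j i)) ⟩
  pairCount K + ΣΣ (λ i j → b2n (lt i j ∧ K j i))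
    ≡⟨ cong (pairCount K +_) (ΣΣ-transpose (λ i j → b2n (lt i j ∧ K j i))) ⟩
  pairCount K + ΣΣ (λ i j → b2n (lt j i ∧ K i j))
    ≡⟨ ΣΣ-distrib-+ (λ i j → b2n (lt i j ∧ K i j)) (λ i j → b2n (lt j i ∧ K i j)) ⟨
  ΣΣ (λ i j → b2n (lt i j ∧ K i j) + b2n (lt j i ∧ K i j))
    ≡⟨ ΣΣ-cong counted-once ⟩
  ΣΣ (λ i j → b2n (K i j)) ∎
  where
  open ≡-Reasoning
  counted-once : ∀ i j → b2n (lt i j ∧ K i j) + b2n (lt j i ∧ K i j) ≡ b2n (K i j)
  counted-once i j with K i j in Kij
  ... | false rewrite Boolₚ.∧-zeroʳ (lt i j) | Boolₚ.∧-zeroʳ (lt j i) = refl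
  ... | true  rewrite Boolₚ.∧-identityʳ (lt i j) | Boolₚ.∧-identityʳ (lt j i) =
    lt-total {i = i} {j} λ { refl → Boolₚ.not-¬ Kij (asym i i Kij) }

pairCount-tight : ∀ {n} (A B : Fin n → Fin n → Bool) → (∀ i j → B i j ≡ true → A i j ≡ true) →
                  pairCount A ≤ pairCount B → ∀ i j → lt i j ≡ true → A i j ≡ true → B i j ≡ true
pairCount-tight A B B⊆A A≤B i j i<j Aij
  with lt i j | A i j | ΣΣ-mono-≤-tight (λ i j → b2n-∧-mono (lt i j) (B⊆A i j)) A≤B i j
... | true | true | [Bij]≡1 = b2n-positive (≤-reflexive (sym [Bij]≡1))

-- Walks

data Walk {n} (A : Adj n) : ℕ → Fin n → Fin n → Set where
  []  : ∀ {u} → Walk A 0 u u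
  _∷_ : ∀ {s u c v} → A u c ≡ true → Walk A s c v → Walk A (suc s) u v

module _ {n} {A : Adj n} where

  walks-positive⇒Walk : ∀ s u v → 0 < walks A s u v → Walk A s u v
  walks-positive⇒Walk zero    u v 0<[u=v]
    with refl ← ==-sound {i = u} {v} (b2n-positive 0<[u=v]) = []
  walks-positive⇒Walk (suc s) u v 0<Σ =
    let c , 0<term = ΣFin-positive _ 0<Σ
        uc , 0<rest = b2n-*-positive (A u c) _ 0<term
    in uc ∷ walks-positive⇒Walk s c v 0<rest

  Walk⇒walks-positive : ∀ {s u v} → Walk A s u v → 0 < walks A s u v
  Walk⇒walks-positive {u = u} [] rewrite ==-refl u = s≤s z≤n
  Walk⇒walks-positive {suc s} {u} {v} (_∷_ {c = c} uc w) =
    <-≤-trans (subst (λ b → 0 < b2n b * walks A s c v) (sym uc)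
                     (subst (0 <_) (sym (+-identityʳ _)) (Walk⇒walks-positive w)))
              (≤-ΣFin (λ k → b2n (A u k) * walks A s k v) c)

  Walk? : ∀ s u v → Dec (Walk A s u v)
  Walk? s u v = map′ (walks-positive⇒Walk s u v) Walk⇒walks-positive (1 ≤? walks A s u v)

  Walk-zero⇒≡ : ∀ {u v} → Walk A 0 u v → u ≡ v
  Walk-zero⇒≡ [] = refl

  _∷ʳ_ : ∀ {s u c v} → Walk A s u c → A c v ≡ true → Walk A (suc s) u v
  []       ∷ʳ cv = cv ∷ []
  (uc ∷ w) ∷ʳ cv = uc ∷ (w ∷ʳ cv)

  unsnoc : ∀ {s u v} → Walk A (suc s) u v → ∃ λ c → Walk A s u c × A c v ≡ true
  unsnoc (uv ∷ [])        = _ , [] , uv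
  unsnoc (uc ∷ w@(_ ∷ _)) = let c , w′ , cv = unsnoc w in c , uc ∷ w′ , cv

  _++_ : ∀ {s t u c v} → Walk A s u c → Walk A t c v → Walk A (s + t) u v
  []       ++ w′ = w′
  (uc ∷ w) ++ w′ = uc ∷ (w ++ w′)

  reverse : (∀ i j → A i j ≡ A j i) → ∀ {s u v} → Walk A s u v → Walk A s v u
  reverse A-sym []                 = []
  reverse A-sym (_∷_ {u = u} uc w) = reverse A-sym w ∷ʳ trans (A-sym _ u) uc

  lazyWalks-positive⇒Walk : ∀ s u v → 0 < lazyWalks A s u v → ∃ λ t → t ≤ s × Walk A t u v
  lazyWalks-positive⇒Walk zero    u v 0<[u=v]
    with refl ← ==-sound {i = u} {v} (b2n-positive 0<[u=v]) = 0 , z≤n , []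
  lazyWalks-positive⇒Walk (suc s) u v 0<Σ
    with c , 0<term ← ΣFin-positive _ 0<Σ
    with stay-or-step , 0<rest ← b2n-*-positive ((u == c) ∨ A u c) _ 0<term
    with t , t≤s , w ← lazyWalks-positive⇒Walk s c v 0<rest
    with u == c in u=c | A u c in uc
  ... | true  | _    with refl ← ==-sound {i = u} {c} u=c = t , m≤n⇒m≤1+n t≤s , w
  ... | false | true = suc t , s≤s t≤s , uc ∷ w

-- Leaves and layers

module _ {n} (G : SimpleGraph n) where

  leafWithin-intro : ∀ {d m v x} → isLeaf G x ≡ true → Walk (adj G) m v x → m ≤ d →
                     leafWithin G d v ≡ true
  leafWithin-intro {d} {m} {v} {x} x-leaf w m≤d =
    dec-true (1 ≤? _) (<-≤-trans 0<term (≤-ΣFin (λ u → b2n (isLeaf G u ∧ within G d v u)) x))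
    where
    x-within : within G d v x ≡ true
    x-within = dec-true (1 ≤? _)
      (<-≤-trans (Walk⇒walks-positive w) (≤-Σupto d (λ s → walks (adj G) s v x) m≤d))
    0<term : 0 < b2n (isLeaf G x ∧ within G d v x)
    0<term rewrite x-leaf | x-within = s≤s z≤n

  leafWithin-elim : ∀ {d v} → leafWithin G d v ≡ true →
                    ∃ λ x → isLeaf G x ≡ true × ∃ λ m → m ≤ d × Walk (adj G) m v x
  leafWithin-elim {d} {v} near
    with x , 0<term ← ΣFin-positive _ (does-true⇒ (1 ≤? _) near)
    with isLeaf G x in x-leaf | within G d v x in x-within
  ... | true | true =
    let m , m≤d , 0<walks = Σupto-positive d _ (does-true⇒ (1 ≤? _) x-within)
    in x , x-leaf , m , m≤d , walks-positive⇒Walk m v x 0<walks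

  leafWithin-mono : ∀ {d d′ v} → d ≤ d′ → leafWithin G d v ≡ true → leafWithin G d′ v ≡ true
  leafWithin-mono d≤d′ near =
    let x , x-leaf , m , m≤d , w = leafWithin-elim near
    in leafWithin-intro x-leaf w (≤-trans m≤d d≤d′)

  card-leafWithin : ∀ m → card (leafWithin G m) ≡ Σ1to (suc m) (layerSize G)
  card-leafWithin zero    = refl
  card-leafWithin (suc m) =
    trans (card-split (leafWithin G (suc m)) (leafWithin G m) (λ _ → leafWithin-mono (n≤1+n m)))
          (cong (_+ layerSize G (suc (suc m))) (card-leafWithin m))

  inLayer⇒leafWithin : ∀ {m v} → inLayer G (suc m) v ≡ true →
                       leafWithin G m v ≡ true × (∀ {d} → d < m → leafWithin G d v ≡ false)
  inLayer⇒leafWithin {zero}  near = near , λ ()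
  inLayer⇒leafWithin {suc m} {v} near-not-nearer
    with leafWithin G (suc m) v | leafWithin G m v in nearer
  ... | true | false = refl , λ d<1+m → Boolₚ.¬-not λ near-d →
    Boolₚ.not-¬ nearer (leafWithin-mono (m<1+n⇒m≤n d<1+m) near-d)

-- Trees rooted at a vertex

module RootedTree {n} (T : SimpleGraph n) (tree : IsTree T) (r : Fin n) where

  private
    A : Adj n
    A = adj T

  adj-sym : ∀ i j → A i j ≡ A j i
  adj-sym = SimpleGraph.sym T

  abstract
    depthWitness : ∀ v → ∃ (Least λ s → Walk A s r v)
    depthWitness v =
      let d , 0<walks = IsTree.connected tree r v
      in least (λ s → Walk? s r v) (walks-positive⇒Walk d r v 0<walks)

  depth : Fin n → ℕ
  depth v = proj₁ (depthWitness v)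

  depth-walk : ∀ v → Walk A (depth v) r v
  depth-walk v = proj₁ (proj₂ (depthWitness v))

  depth-≤ : ∀ {s v} → Walk A s r v → depth v ≤ s
  depth-≤ {v = v} w = ≮⇒≥ λ s<depth → proj₂ (proj₂ (depthWitness v)) s<depth w

  depth-root : depth r ≡ 0
  depth-root = n≤0⇒n≡0 (depth-≤ [])

  depth≡0⇒root : ∀ {v} → depth v ≡ 0 → v ≡ r
  depth≡0⇒root {v} d≡0 = sym (Walk-zero⇒≡ (subst (λ s → Walk A s r v) d≡0 (depth-walk v)))

  depth-triangle : ∀ {s a b} → Walk A s a b → depth b ≤ depth a + s
  depth-triangle {a = a} w = depth-≤ (depth-walk a ++ w)

  depth-triangle′ : ∀ {s a b} → Walk A s a b → depth a ≤ depth b + s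
  depth-triangle′ w = depth-triangle (reverse adj-sym w)

  depth-adj : ∀ {a b} → A a b ≡ true → depth b ≤ suc (depth a)
  depth-adj {a} {b} ab = subst (depth b ≤_) (+-comm (depth a) 1) (depth-triangle (ab ∷ []))

  parentWitness : ∀ {v} → v ≢ r → ∃ λ p → A p v ≡ true × suc (depth p) ≡ depth v
  parentWitness {v} v≢r with depth v in d≡
  ... | zero  = ⊥-elim (v≢r (depth≡0⇒root d≡))
  ... | suc m with p , rp , pv ← unsnoc (subst (λ s → Walk A s r v) d≡ (depth-walk v)) =
    p , pv , ≤-antisym (s≤s (depth-≤ rp)) (subst (_≤ _) d≡ (depth-adj pv))

  -- parent r = r is a junk value.
  parent : Fin n → Fin n
  parent v with v Finₚ.≟ r
  ... | yes _  = r
  ... | no v≢r = proj₁ (parentWitness v≢r)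

  parent-spec : ∀ {v} → v ≢ r → A (parent v) v ≡ true × suc (depth (parent v)) ≡ depth v
  parent-spec {v} v≢r with v Finₚ.≟ r
  ... | yes v≡r  = ⊥-elim (v≢r v≡r)
  ... | no  v≢r′ = proj₂ (parentWitness v≢r′)

  IsParentOf : Fin n → Fin n → Bool
  IsParentOf p c = (parent c == p) ∧ not (c == r)

  IsParentOf⇒ : ∀ {p c} → IsParentOf p c ≡ true → parent c ≡ p × c ≢ r
  IsParentOf⇒ {p} {c} pc with parent c == p in c↑p | c == r in c=r
  ... | true | false = ==-sound {i = parent c} {p} c↑p , does-false⇒ (c Finₚ.≟ r) c=r

  IsParentOf⇒adj : ∀ {p c} → IsParentOf p c ≡ true → A p c ≡ true
  IsParentOf⇒adj {p} {c} pc with refl , c≢r ← IsParentOf⇒ {p} {c} pc = proj₁ (parent-spec c≢r)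

  IsParentOf⇒depth : ∀ {p c} → IsParentOf p c ≡ true → suc (depth p) ≡ depth c
  IsParentOf⇒depth {p} {c} pc with refl , c≢r ← IsParentOf⇒ {p} {c} pc = proj₂ (parent-spec c≢r)

  IsParentOf-asym : ∀ p c → IsParentOf p c ≡ true → IsParentOf c p ≡ false
  IsParentOf-asym p c pc = Boolₚ.¬-not λ cp →
    <-asym (≤-reflexive (IsParentOf⇒depth {p} {c} pc)) (≤-reflexive (IsParentOf⇒depth {c} {p} cp))

  parentArcCount : ΣΣ (λ p c → b2n (IsParentOf p c)) ≡ n ∸ 1
  parentArcCount = begin
    ΣΣ (λ p c → b2n (IsParentOf p c))
      ≡⟨ ΣΣ-transpose (λ p c → b2n (IsParentOf p c)) ⟩
    ΣΣ (λ c p → b2n (IsParentOf p c))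
      ≡⟨ sum-cong-≗ {n} (λ c → ΣFin-at _ (parent c) λ p p≢parent →
           cong (λ b → b2n (b ∧ _)) (≢⇒==-false (p≢parent ∘ sym))) ⟩
    ΣFin (λ c → b2n (IsParentOf (parent c) c))
      ≡⟨ sum-cong-≗ {n} (λ c → cong (λ b → b2n (b ∧ _)) (==-refl (parent c))) ⟩
    card (λ c → not (c == r))
      ≡⟨ card-remove (λ _ → true) {r} refl ⟩
    card {n} (λ _ → true) ∸ 1
      ≡⟨ cong (_∸ 1) (card-full n) ⟩
    n ∸ 1 ∎
    where open ≡-Reasoning

  ParentEdge : Fin n → Fin n → Bool
  ParentEdge i j = IsParentOf i j ∨ IsParentOf j i

  parentEdge⇒adj : ∀ i j → ParentEdge i j ≡ true → A i j ≡ true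
  parentEdge⇒adj i j ij with ∨-true⇒ ij
  ... | inj₁ i↑j = IsParentOf⇒adj i↑j
  ... | inj₂ j↑i = trans (adj-sym i j) (IsParentOf⇒adj j↑i)

  -- A tree has n - 1 edges, and the n - 1 parent edges are among them, so there are no others.
  pairCount-adj≤pairCount-parentEdge : pairCount A ≤ pairCount ParentEdge
  pairCount-adj≤pairCount-parentEdge = ≤-reflexive (begin
    pairCount A                        ≡⟨ IsTree.edges tree ⟩
    n ∸ 1                              ≡⟨ parentArcCount ⟨
    ΣΣ (λ p c → b2n (IsParentOf p c))  ≡⟨ pairCount-symmetrise IsParentOf IsParentOf-asym ⟨
    pairCount ParentEdge               ∎)
    where open ≡-Reasoning

  ordered-adj⇒parentEdge : ∀ i j → lt i j ≡ true → A i j ≡ true → ParentEdge i j ≡ true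
  ordered-adj⇒parentEdge =
    pairCount-tight A ParentEdge parentEdge⇒adj pairCount-adj≤pairCount-parentEdge

  adj⇒parentEdge : ∀ {a b} → A a b ≡ true → ParentEdge a b ≡ true
  adj⇒parentEdge {a} {b} ab with <-cmp (toℕ a) (toℕ b)
  ... | tri< a<b _ _ = ordered-adj⇒parentEdge a b (dec-true (toℕ a <? toℕ b) a<b) ab
  ... | tri≈ _ a=b _ rewrite Finₚ.toℕ-injective a=b =
    ⊥-elim (Boolₚ.not-¬ (SimpleGraph.irrefl T b) ab)
  ... | tri> _ _ b<a =
    trans (Boolₚ.∨-comm (IsParentOf a b) (IsParentOf b a))
          (ordered-adj⇒parentEdge b a (dec-true (toℕ b <? toℕ a) b<a) (trans (adj-sym b a) ab))

  adj⇒depth-step : ∀ {a b} → A a b ≡ true → suc (depth a) ≡ depth b ⊎ suc (depth b) ≡ depth a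
  adj⇒depth-step {a} {b} ab with ∨-true⇒ (adj⇒parentEdge ab)
  ... | inj₁ a↑b = inj₁ (IsParentOf⇒depth {a} {b} a↑b)
  ... | inj₂ b↑a = inj₂ (IsParentOf⇒depth {b} {a} b↑a)

  parent-unique : ∀ {p c} → A p c ≡ true → suc (depth p) ≡ depth c → p ≡ parent c
  parent-unique {p} {c} pc p↑c with ∨-true⇒ (adj⇒parentEdge pc)
  ... | inj₁ p↑c′ = sym (proj₁ (IsParentOf⇒ {p} {c} p↑c′))
  ... | inj₂ c↑p  =
    ⊥-elim (<-asym (≤-reflexive p↑c) (≤-reflexive (IsParentOf⇒depth {c} {p} c↑p)))

  adj-nonparent⇒child : ∀ {c d} → A c d ≡ true → d ≢ parent c → depth d ≡ suc (depth c)
  adj-nonparent⇒child {c} {d} cd d≢parent with adj⇒depth-step cd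
  ... | inj₁ c↑d = sym c↑d
  ... | inj₂ d↑c = ⊥-elim (d≢parent (parent-unique (trans (adj-sym d c) cd) d↑c))

  nonLeaf⇒child : ∀ {c} → c ≢ r → isLeaf T c ≡ false →
                  ∃ λ d → A c d ≡ true × depth d ≡ suc (depth c)
  nonLeaf⇒child {c} c≢r c-nonleaf =
    let d , d≢parent , cd = card≥2⇒∃≢ (A c) (parent c) degree≥2
    in d , cd , adj-nonparent⇒child cd d≢parent
    where
    degree≥1 : 1 ≤ degree T c
    degree≥1 = card-positive (A c) (trans (adj-sym c (parent c)) (proj₁ (parent-spec c≢r)))
    degree≥2 : 2 ≤ degree T c
    degree≥2 = ≤∧≢⇒< degree≥1 λ 1≡degree → does-false⇒ (degree T c ≟ 1) c-nonleaf (sym 1≡degree)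

  leafRoot⇒child : isLeaf T r ≡ true → ∃ λ d → A r d ≡ true × depth d ≡ 1
  leafRoot⇒child r-leaf
    with d , 0<[rd] ← ΣFin-positive _ (≤-reflexive (sym (does-true⇒ (degree T r ≟ 1) r-leaf)))
    with adj⇒depth-step (b2n-positive 0<[rd])
  ... | inj₁ r↑d = d , b2n-positive 0<[rd] , trans (sym r↑d) (cong suc depth-root)
  ... | inj₂ d↑r = ⊥-elim (0≢1+n (trans (sym depth-root) (sym d↑r)))

  ancestor : ℕ → Fin n → Fin n
  ancestor zero    v = v
  ancestor (suc s) v = parent (ancestor s v)

  -- Climbing s levels in s steps, every step of the walk goes from a parent to its child.
  descending⇒ancestor : ∀ {s a u} → Walk A s a u → depth u ≡ depth a + s → a ≡ ancestor s u
  descending⇒ancestor [] _ = refl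
  descending⇒ancestor {suc s} {a} {u} (_∷_ {c = c} ac w) du =
    trans (parent-unique ac a↑c) (cong parent (descending⇒ancestor w du′))
    where
    open ≤-Reasoning
    a↑c : suc (depth a) ≡ depth c
    a↑c = ≤-antisym (+-cancelʳ-≤ s _ _ (begin
      suc (depth a) + s   ≡⟨ +-suc (depth a) s ⟨
      depth a + suc s     ≡⟨ du ⟨
      depth u             ≤⟨ depth-triangle w ⟩
      depth c + s         ∎)) (depth-adj ac)
    du′ : depth u ≡ depth c + s
    du′ = trans du (trans (+-suc (depth a) s) (cong (_+ s) a↑c))

  descend : ∀ {w m} → w ≢ r → leafWithin T m w ≡ false →
            ∀ j → j ≤ suc m → ∃ λ u → Walk A j w u × depth u ≡ depth w + j
  descend {w} w≢r far zero    _ = w , [] , sym (+-identityʳ (depth w))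
  descend {w} w≢r far (suc j) j<1+m
    with u , wu , du ← descend w≢r far j (<⇒≤ j<1+m)
    with isLeaf T u in u-leaf
  ... | true  = ⊥-elim (Boolₚ.not-¬ far (leafWithin-intro T u-leaf wu (m<1+n⇒m≤n j<1+m)))
  ... | false =
    let d , ud , dd = nonLeaf⇒child u≢r u-leaf
    in d , wu ∷ʳ ud , trans dd (trans (cong suc du) (sym (+-suc (depth w) j)))
    where
    u≢r : u ≢ r
    u≢r refl = w≢r (depth≡0⇒root (m+n≡0⇒m≡0 (depth w) (trans (sym du) depth-root)))

  lazyWalks-short : ∀ {s c} → s < depth c → lazyWalks A s c r ≡ 0
  lazyWalks-short {s} {c} s<depth = n<1⇒n≡0 (≰⇒> λ 0<lazy →
    let t , t≤s , w = lazyWalks-positive⇒Walk s c r 0<lazy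
    in <⇒≱ s<depth (≤-trans (depth-≤ (reverse adj-sym w)) t≤s))

  -- A lazy walk of length depth c from c to the root can neither pause nor leave the path
  -- through the ancestors of c.
  lazyWalks-geodesic : ∀ {s c} → depth c ≡ s → lazyWalks A s c r ≡ 1
  lazyWalks-geodesic {zero}  {c} d≡0 rewrite depth≡0⇒root d≡0 = cong b2n (==-refl r)
  lazyWalks-geodesic {suc s} {c} d≡1+s = trans (ΣFin-at step (parent c) off-parent) at-parent
    where
    c≢r : c ≢ r
    c≢r refl = 0≢1+n (trans (sym depth-root) d≡1+s)
    step : Fin n → ℕ
    step d = b2n ((c == d) ∨ A c d) * lazyWalks A s d r
    at-parent : step (parent c) ≡ 1
    at-parent rewrite trans (adj-sym c (parent c)) (proj₁ (parent-spec c≢r))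
                    | Boolₚ.∨-zeroʳ (c == parent c)
                    | lazyWalks-geodesic (suc-injective (trans (proj₂ (parent-spec c≢r)) d≡1+s)) = refl
    no-step : ∀ {d} → depth d ≤ s → d ≢ parent c → ((c == d) ∨ A c d) ≡ false
    no-step {d} d≤s d≢parent with A c d in cd
    ... | true  = ⊥-elim (1+n≰n (≤-trans (n≤1+n (suc s))
                    (subst (_≤ s) (trans (adj-nonparent⇒child cd d≢parent) (cong suc d≡1+s)) d≤s)))
    ... | false = trans (Boolₚ.∨-identityʳ (c == d))
                        (≢⇒==-false {i = c} {d} λ { refl → 1+n≰n (subst (_≤ s) d≡1+s d≤s) })
    off-parent : ∀ d → d ≢ parent c → step d ≡ 0
    off-parent d d≢parent with depth d ≤? s
    ... | yes d≤s rewrite no-step d≤s d≢parent = refl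
    ... | no  d≰s = trans (cong (b2n ((c == d) ∨ A c d) *_) (lazyWalks-short (≰⇒> d≰s)))
                          (*-zeroʳ (b2n ((c == d) ∨ A c d)))

  Γmult-geodesic : ∀ u → Γmult T (depth u) u r ≡ 1
  Γmult-geodesic u =
    trans (Σupto-last (depth u) (λ s → lazyWalks A s u r) lazyWalks-short) (lazyWalks-geodesic refl)

inLayer⇒leafRoot : ∀ {n} (T : SimpleGraph n) (tree : IsTree T) {m x} → inLayer T (suc m) x ≡ true →
                   ∃ λ ρ → isLeaf T ρ ≡ true × ∃ λ y → RootedTree.depth T tree ρ y ≡ suc m
inLayer⇒leafRoot T tree {zero} {x} x∈L₁ with ℓ , ℓ-leaf , _ ← leafWithin-elim T {0} {x} x∈L₁ =
  let y , _ , dy = RootedTree.leafRoot⇒child T tree ℓ ℓ-leaf in ℓ , ℓ-leaf , y , dy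
inLayer⇒leafRoot T tree {suc j} {x} x∈L
  with x-near , x-not-nearer ← inLayer⇒leafWithin T x∈L
  with ℓ , ℓ-leaf , t , t≤1+j , xℓ ← leafWithin-elim T x-near =
  let y , _ , dy = nonLeaf⇒child x≢ℓ x-nonleaf in ℓ , ℓ-leaf , y , trans dy (cong suc depth-x)
  where
  open RootedTree T tree ℓ
  depth-x : depth x ≡ suc j
  depth-x = ≤-antisym (≤-trans (depth-≤ (reverse adj-sym xℓ)) t≤1+j) (≮⇒≥ λ dx<1+j →
    Boolₚ.not-¬ (x-not-nearer dx<1+j)
                (leafWithin-intro T ℓ-leaf (reverse adj-sym (depth-walk x)) ≤-refl))
  x≢ℓ : x ≢ ℓ
  x≢ℓ refl = 0≢1+n (trans (sym depth-root) depth-x)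
  x-nonleaf : isLeaf T x ≡ false
  x-nonleaf = Boolₚ.¬-not λ x-leaf →
    Boolₚ.not-¬ (x-not-nearer (s≤s z≤n)) (leafWithin-intro T {0} x-leaf [] z≤n)

-- Forcing from the leaf neighbourhood

module LeafNeighbourhoodForcing
  {n} (T : SimpleGraph n) (tree : IsTree T) (k′ : ℕ) (ρ y : Fin n)
  (depth-y : RootedTree.depth T tree ρ y ≡ suc k′)
  (H : SimpleGraph n) (H-config : IsEdgeConfiguration T (suc k′) H) where

  open RootedTree T tree ρ

  H-adj⇒near : ∀ {u x} → adj H u x ≡ true → ∃ λ t → t ≤ suc k′ × Walk (adj T) t u x
  H-adj⇒near {u} {x} ux =
    let s , s≤k , 0<lazy = Σupto-positive (suc k′) _ (n≢0⇒n>0 λ Γ≡0 →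
                             Boolₚ.not-¬ (IsEdgeConfiguration.none H-config u x u≢x Γ≡0) ux)
        t , t≤s , w = lazyWalks-positive⇒Walk s u x 0<lazy
    in t , ≤-trans t≤s s≤k , w
    where
    u≢x : u ≢ x
    u≢x refl = Boolₚ.not-¬ (SimpleGraph.irrefl H u) ux

  H-adj-geodesic : ∀ {u w} → RootedTree.depth T tree w u ≡ suc k′ → adj H u w ≡ true
  H-adj-geodesic {u} {w} du = IsEdgeConfiguration.single H-config u w u≢w
    (subst (λ k → Γmult T k u w ≡ 1) du (RootedTree.Γmult-geodesic T tree w u))
    where
    u≢w : u ≢ w
    u≢w refl = 0≢1+n (trans (sym (RootedTree.depth-root T tree u)) du)

  WhiteFar : Colouring n → Set
  WhiteFar B = ∀ v → B v ≡ false → v ≡ ρ ⊎ leafWithin T k′ v ≡ false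

  paint : Fin n → Colouring n → Colouring n
  paint w B v = (v == w) ∨ B v

  paint-whites : ∀ {B w} → B w ≡ false → card (not ∘ paint w B) ≡ card (not ∘ B) ∸ 1
  paint-whites {B} {w} w-white =
    trans (sum-cong-≗ {n} λ v → cong b2n (trans (not-∨ (v == w) (B v))
                                                (Boolₚ.∧-comm (not (v == w)) (not (B v)))))
          (card-remove (not ∘ B) (cong not w-white))

  deep-descendant : ∀ {B w} → WhiteFar B → B w ≡ false →
                    ∃ λ u → Walk (adj T) (suc k′) w u × depth u ≡ depth w + suc k′
  deep-descendant {w = w} far w-white with w Finₚ.≟ ρ | far w w-white
  ... | yes refl | _          = y , subst (λ s → Walk (adj T) s ρ y) depth-y (depth-walk y) ,
                                trans depth-y (cong (_+ suc k′) (sym depth-root))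
  ... | no  w≢ρ  | inj₁ w≡ρ   = ⊥-elim (w≢ρ w≡ρ)
  ... | no  w≢ρ  | inj₂ w-far = descend w≢ρ w-far (suc k′) ≤-refl

  force-deepest : ∀ {B w} → WhiteFar B → B w ≡ false → (∀ v → B v ≡ false → depth v ≤ depth w) →
                  Force H B (paint w B)
  force-deepest {B} {w} far w-white deepest with u , wu , du ← deep-descendant far w-white = record
    { u          = u
    ; v          = w
    ; uBlue      = Boolₚ.¬-not λ u-white →
                     m+1+n≰m (depth w) (subst (_≤ depth w) du (deepest u u-white))
    ; vWhite     = w-white
    ; uv         = H-adj-geodesic (≤-antisym (W.depth-≤ wu) (+-cancelˡ-≤ (depth w) _ _
                     (subst (_≤ depth w + W.depth u) du (depth-triangle (W.depth-walk u)))))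
    ; othersBlue = λ x ux x≢w → Boolₚ.¬-not (x≢w ∘ white-neighbour⇒w ux)
    ; vNowBlue   = cong (_∨ B w) (==-refl w)
    ; unchanged  = λ x x≢w → cong (_∨ B x) (≢⇒==-false x≢w)
    }
    where
    module W = RootedTree T tree w
    white-neighbour⇒w : ∀ {x} → adj H u x ≡ true → B x ≡ false → x ≡ w
    white-neighbour⇒w {x} ux x-white
      with t , t≤k , u-x ← H-adj⇒near ux
      with dx≡dw , refl ← +-mono-≤-tight (deepest x x-white) t≤k
                            (subst (_≤ depth x + t) du (depth-triangle′ u-x)) =
      trans (descending⇒ancestor (reverse adj-sym u-x) (trans du (cong (_+ suc k′) (sym dx≡dw))))
            (sym (descending⇒ancestor wu du))

  forceAll : ∀ m B → card (not ∘ B) ≡ m → WhiteFar B →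
             ∃ λ B′ → Star (Force H) B B′ × (∀ x → B′ x ≡ true)
  forceAll zero    B no-whites _ = B , ε , λ x → Boolₚ.¬-not λ x-white →
    <⇒≢ (card-positive (not ∘ B) (cong not x-white)) (sym no-whites)
  forceAll (suc m) B whites far
    with x , 0<[x-white] ← ΣFin-positive (λ v → b2n (not (B v))) (subst (0 <_) (sym whites) (s≤s z≤n))
    with w , w-white , deepest ← argmax-Fin (not ∘ B) depth (b2n-positive 0<[x-white])
    with w-white′ ← Boolₚ.not-injective w-white
    with B′ , forcing , all-blue ← forceAll m (paint w B)
                                     (trans (paint-whites w-white′) (cong (_∸ 1) whites))
                                     (λ v v-white → far v (Boolₚ.∨-conicalʳ _ _ v-white)) =
    B′ , force-deepest far w-white′ (λ v v-white → deepest v (cong not v-white)) ◅ forcing , all-blue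

  S : Colouring n
  S v = leafWithin T k′ v ∧ not (v == ρ)

  S-whiteFar : WhiteFar S
  S-whiteFar v v-white with leafWithin T k′ v | v == ρ in v=ρ
  ... | false | _    = inj₂ refl
  ... | true  | true = inj₁ (==-sound {i = v} {ρ} v=ρ)

  S-zeroForcing : IsZeroForcingSet H S
  S-zeroForcing = forceAll _ S refl S-whiteFar

mainTheorem7 : ∀ {n} (T : SimpleGraph n) → IsTree T →
    ∀ (k : ℕ) → 1 ≤ k → (∃ λ (v : Fin n) → inLayer T k v ≡ true) →
    ∀ z → IsZr T k z → z ≤ Σ1to k (layerSize T) ∸ 1
mainTheorem7 T tree (suc k′) _ (x , x∈Lk) z ((H , H-config , _ , Z-minimal) , _)
  with ρ , ρ-leaf , y , depth-y ← inLayer⇒leafRoot T tree x∈Lk = begin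
    z                                ≤⟨ Z-minimal S S-zeroForcing ⟩
    card S                           ≡⟨ card-remove (leafWithin T k′) ρ-near ⟩
    card (leafWithin T k′) ∸ 1       ≡⟨ cong (_∸ 1) (card-leafWithin T k′) ⟩
    Σ1to (suc k′) (layerSize T) ∸ 1  ∎
  where
  open LeafNeighbourhoodForcing T tree k′ ρ y depth-y H H-config
  open ≤-Reasoning
  ρ-near : leafWithin T k′ ρ ≡ true
  ρ-near = leafWithin-intro T {k′} ρ-leaf [] z≤n
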